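{- Let $q$ be a positive integer and consider an instance of \textsc{Min-Lin-Eq}$(q)$-\textsc{Full} on the complete graph with $n$ vertices and $m=\binom n2$ edges. Fix an optimal assignment $\mathrm{OPT}$ (minimizing the number of unsatisfied constraints), let $\mathrm{OPT}_{val}$ be its number of unsatisfied constraints, let $\varepsilon=\mathrm{OPT}_{val}/m$, assume $\varepsilon<\frac12$, and let $\nu=2/(1-2\varepsilon)$. Call an edge red if its constraint is not satisfied by $\mathrm{OPT}$, and call a vertex $v$ flippable if the number of red edges incident to $v$ is at least $(n-1)/2-\varepsilon(n-1)$. Then there are at most $\varepsilon\nu n$ flippable vertices.
   Context: \textsc{Min-Lin-Eq}$(q)$-\textsc{Full}: given the complete simple graph $G=(V,E)$ on $n$ vertices, a positive integer $q$, and for each ordered pair of distinct vertices $(u,v)$ an integer $c_{uv}\in[q]=\{0,\dots,q-1\}$ with $c_{vu}=q-c_{uv}\bmod q$, each edge $uv$ carries the constraint $x_u-x_v\equiv c_{uv}\pmod q$. An assignment is a map $x:V\to[q]$; the goal is to minimize the number of unsatisfied constraints. -}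

module Defs where

open import Data.Nat using (ℕ; zero; suc; _+_; _*_; _∸_; _≤_; _<_; _≟_; NonZero)
open import Data.Nat.DivMod using (_%_)
open import Data.Nat.Combinatorics using (_C_)
open import Data.Fin using (Fin; toℕ)
open import Data.List using (List; length; filter)
open import Relation.Nullary using (¬_; Dec; yes; no)
open import Relation.Nullary.Decidable using (¬?)
open import Relation.Binary.PropositionalEquality using (_≡_)

open import Data.Fin using () renaming (_<?_ to _<ᶠ?_)
import Data.List as L
open import Data.Nat.ListAction using (sum)
open import Relation.Nullary.Decidable using (_×-dec_)
open import Data.Nat using (_≤?_)
import Data.Fin

allVertices : (n : ℕ) → List (Fin n)
allVertices n = L.allFin n

countFin : {n : ℕ} {P : Fin n → Set} → ((i : Fin n) → Dec (P i)) → ℕ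
countFin {n} P? = length (filter P? (allVertices n))

-- An instance of Min-Lin-Eq(q)-Full on K_n: a label c u v ∈ [q] for each ordered
-- pair of distinct vertices, with c v u = (q - c u v) mod q.
Labels : ℕ → ℕ → Set
Labels n q = Fin n → Fin n → Fin q

Antisymmetric : {n q : ℕ} .{{_ : NonZero q}} → Labels n q → Set
Antisymmetric {n} {q} c =
  (u v : Fin n) → ¬ (u ≡ v) → toℕ (c v u) ≡ (q ∸ toℕ (c u v)) % q

Assignment : ℕ → ℕ → Set
Assignment n q = Fin n → Fin q

Satisfied : {n q : ℕ} .{{_ : NonZero q}} → Labels n q → Assignment n q → Fin n → Fin n → Set
Satisfied {q = q} c x u v = (toℕ (x u) + (q ∸ toℕ (x v))) % q ≡ toℕ (c u v)

satisfied? : {n q : ℕ} .{{_ : NonZero q}} (c : Labels n q) (x : Assignment n q) (u v : Fin n) →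
             Dec (Satisfied c x u v)
satisfied? {q = q} c x u v = ((toℕ (x u) + (q ∸ toℕ (x v))) % q) ≟ toℕ (c u v)

-- the edge {u,v} is unsatisfied (red w.r.t. x): we read the constraint of the
-- edge in the orientation (smaller index, larger index); by antisymmetry of c
-- the orientation does not matter.
EdgeUnsat : {n q : ℕ} .{{_ : NonZero q}} → Labels n q → Assignment n q → Fin n → Fin n → Set
EdgeUnsat c x u v with u <ᶠ? v
... | yes _ = ¬ Satisfied c x u v
... | no  _ = ¬ Satisfied c x v u

edgeUnsat? : {n q : ℕ} .{{_ : NonZero q}} (c : Labels n q) (x : Assignment n q) (u v : Fin n) →
             Dec (EdgeUnsat c x u v)
edgeUnsat? c x u v with u <ᶠ? v
... | yes _ = ¬? (satisfied? c x u v)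
... | no  _ = ¬? (satisfied? c x v u)

cost : {n q : ℕ} .{{_ : NonZero q}} → Labels n q → Assignment n q → ℕ
cost {n} c x = sum (L.map (λ u → countFin (λ v → (u <ᶠ? v) ×-dec (edgeUnsat? c x u v))) (allVertices n))

Optimal : {n q : ℕ} .{{_ : NonZero q}} → Labels n q → Assignment n q → Set
Optimal {n} {q} c x = (y : Assignment n q) → cost c x ≤ cost c y

redDeg : {n q : ℕ} .{{_ : NonZero q}} → Labels n q → Assignment n q → Fin n → ℕ
redDeg c x v = countFin (λ u → (¬? (u Data.Fin.≟ v)) ×-dec (edgeUnsat? c x u v))

edges : ℕ → ℕ
edges n = n C 2

-- v is flippable:  redDeg v ≥ (n-1)/2 - ε(n-1), with ε = cost/m, m = C(n,2).
-- Multiplying by 2m > 0 this reads  2·m·redDeg v ≥ (n-1)·(m - 2·cost)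
-- (under the standing assumption ε < 1/2, i.e. 2·cost < m, the right side is exact).
Flippable : {n q : ℕ} .{{_ : NonZero q}} → Labels n q → Assignment n q → Fin n → Set
Flippable {n} c x v = (n ∸ 1) * (edges n ∸ 2 * cost c x) ≤ 2 * edges n * redDeg c x v

flippable? : {n q : ℕ} .{{_ : NonZero q}} (c : Labels n q) (x : Assignment n q) (v : Fin n) →
             Dec (Flippable c x v)
flippable? {n} c x v = ((n ∸ 1) * (edges n ∸ 2 * cost c x)) ≤? (2 * edges n * redDeg c x v)

numFlippable : {n q : ℕ} .{{_ : NonZero q}} → Labels n q → Assignment n q → ℕ
numFlippable c x = countFin (flippable? c x)

{-# OPTIONS --safe #-}
-- Every flippable vertex has red degree at least (n-1)(1-2ε)/2, while the red degrees add
-- up to 2·OPT_val (each red edge is counted at both ends).  Counting the vertices whose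
-- degree reaches this threshold (Markov's inequality) gives at most
-- 2·OPT_val / ((n-1)(1-2ε)/2) = εν·n of them, using 2m = n(n-1).
module Submission where

open import Defs
open import Data.Nat using (ℕ; zero; suc; _+_; _*_; _∸_; _≤_; _<_; _≤?_; z≤n; NonZero)
open import Data.Nat.Properties hiding (_<?_; _≟_)
open import Data.Nat.Combinatorics using (_C_; nC1≡n; nCk+nC[k+1]≡[n+1]C[k+1])
import Data.Nat.ListAction as List
open import Data.Bool using (true; false; if_then_else_)
open import Data.Fin using (Fin; toℕ; _<?_; _≟_) renaming (zero to fzero; suc to fsuc)
import Data.Fin.Properties as Fin
open import Data.List using (length; filter; tabulate; map)
open import Data.List.Properties using (map-tabulate)
open import Data.Empty using (⊥-elim)
open import Function using (_∘_; id)
open import Relation.Nullary using (Dec; does; yes; no)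
open import Relation.Nullary.Decidable using (¬?; _×-dec_; dec-true; dec-false)
open import Relation.Binary.Definitions using (tri<; tri≈; tri>)
open import Relation.Unary using (Decidable)
open import Relation.Binary.PropositionalEquality using (_≡_; refl; sym; trans; cong; cong₂; module ≡-Reasoning)
import Algebra.Properties.CommutativeSemigroup as CommutativeSemigroupProperties
open import Algebra.Properties.Semiring.Sum +-*-semiring
  using (sum; sum-syntax; sum-cong-≗; ∑-distrib-+; ∑-comm; *-distribˡ-sum; *-distribʳ-sum)

[_] : {P : Set} → Dec P → ℕ
[ P? ] = if does P? then 1 else 0

∑-mono-≤ : ∀ {n} {f g : Fin n → ℕ} → (∀ i → f i ≤ g i) → sum f ≤ sum g
∑-mono-≤ {zero}  _   = z≤n
∑-mono-≤ {suc n} f≤g = +-mono-≤ (f≤g fzero) (∑-mono-≤ (f≤g ∘ fsuc))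

length-filter-tabulate : ∀ {m} {A : Set} {P : A → Set} (P? : Decidable P) (g : Fin m → A) →
                         length (filter P? (tabulate g)) ≡ ∑[ i < m ] [ P? (g i) ]
length-filter-tabulate {m = zero}  P? g = refl
length-filter-tabulate {m = suc m} P? g with does (P? (g fzero))
... | true  = cong suc (length-filter-tabulate P? (g ∘ fsuc))
... | false = length-filter-tabulate P? (g ∘ fsuc)

countFin≡∑ : ∀ {n} {P : Fin n → Set} (P? : Decidable P) → countFin P? ≡ ∑[ i < n ] [ P? i ]
countFin≡∑ P? = length-filter-tabulate P? id

sum-tabulate : ∀ {m} (f : Fin m → ℕ) → List.sum (tabulate f) ≡ sum f
sum-tabulate {zero}  f = refl
sum-tabulate {suc m} f = cong (f fzero +_) (sum-tabulate (f ∘ fsuc))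

markov : ∀ {n} t (f : Fin n → ℕ) → countFin (λ i → t ≤? f i) * t ≤ ∑[ i < n ] f i
markov {n} t f = begin
  countFin (λ i → t ≤? f i) * t   ≡⟨ cong (_* t) (countFin≡∑ (λ i → t ≤? f i)) ⟩
  sum (λ i → [ t ≤? f i ]) * t    ≡⟨ *-distribʳ-sum t (λ i → [ t ≤? f i ]) ⟩
  ∑[ i < n ] ([ t ≤? f i ] * t)  ≤⟨ ∑-mono-≤ (λ i → indicator*t≤ (t ≤? f i)) ⟩
  ∑[ i < n ] f i                 ∎
  where
  open ≤-Reasoning
  indicator*t≤ : ∀ {s} (t≤? : Dec (t ≤ s)) → [ t≤? ] * t ≤ s
  indicator*t≤ (yes t≤s) = ≤-trans (≤-reflexive (+-identityʳ t)) t≤s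
  indicator*t≤ (no _)    = z≤n

2*nC2≡n*[n∸1] : ∀ n → 2 * (n C 2) ≡ n * (n ∸ 1)
2*nC2≡n*[n∸1] zero          = refl
2*nC2≡n*[n∸1] (suc zero)    = refl
2*nC2≡n*[n∸1] (suc (suc n)) = begin
  2 * (suc (suc n) C 2)        ≡⟨ cong (2 *_) (sym (nCk+nC[k+1]≡[n+1]C[k+1] (suc n) 1)) ⟩
  2 * (suc n C 1 + suc n C 2)  ≡⟨ cong (λ t → 2 * (t + suc n C 2)) (nC1≡n (suc n)) ⟩
  2 * (suc n + suc n C 2)      ≡⟨ *-distribˡ-+ 2 (suc n) _ ⟩
  2 * suc n + 2 * (suc n C 2)  ≡⟨ cong (2 * suc n +_) (2*nC2≡n*[n∸1] (suc n)) ⟩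
  2 * suc n + suc n * n        ≡⟨ cong (2 * suc n +_) (*-comm (suc n) n) ⟩
  2 * suc n + n * suc n        ≡⟨ sym (*-distribʳ-+ (suc n) 2 n) ⟩
  suc (suc n) * suc n          ∎
  where open ≡-Reasoning

module _ {n q : ℕ} .{{_ : NonZero q}} (c : Labels n q) (x : Assignment n q) where

  redForward : Fin n → Fin n → ℕ
  redForward u v = [ (u <? v) ×-dec edgeUnsat? c x u v ]

  cost≡∑∑redForward : cost c x ≡ ∑[ u < n ] ∑[ v < n ] redForward u v
  cost≡∑∑redForward = begin
    List.sum (map redCount (tabulate id))  ≡⟨ cong List.sum (map-tabulate id redCount) ⟩
    List.sum (tabulate redCount)           ≡⟨ sum-tabulate redCount ⟩
    sum redCount                           ≡⟨ sum-cong-≗ (λ u → countFin≡∑ (λ v → (u <? v) ×-dec edgeUnsat? c x u v)) ⟩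
    ∑[ u < n ] ∑[ v < n ] redForward u v   ∎
    where
    open ≡-Reasoning
    redCount : Fin n → ℕ
    redCount u = countFin (λ v → (u <? v) ×-dec edgeUnsat? c x u v)

  edgeUnsat-sym : ∀ {u v} → toℕ v < toℕ u → does (edgeUnsat? c x u v) ≡ does (edgeUnsat? c x v u)
  edgeUnsat-sym {u} {v} v<u with u <? v | v <? u
  ... | yes u<v | _     = ⊥-elim (Fin.<-asym u<v v<u)
  ... | no _    | yes _ = refl
  ... | no _    | no v≮u = ⊥-elim (v≮u v<u)

  -- The decisions of u < v and v < u are arguments because, once `does (u <? v)` has computed
  -- to `toℕ u <ᵇ toℕ v`, with-abstraction can no longer reach them.
  redIncident≡redForward+redBackward : ∀ u v (u<?v : Dec (toℕ u < toℕ v)) (v<?u : Dec (toℕ v < toℕ u)) →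
    [ ¬? (u ≟ v) ×-dec edgeUnsat? c x u v ] ≡ [ u<?v ×-dec edgeUnsat? c x u v ] + [ v<?u ×-dec edgeUnsat? c x v u ]
  redIncident≡redForward+redBackward u v u<?v v<?u with Fin.<-cmp u v | u<?v | v<?u
  ... | tri< _ u≢v _   | yes _   | no _ rewrite dec-false (u ≟ v) u≢v = sym (+-identityʳ _)
  ... | tri> _ u≢v v<u | no _    | yes _ rewrite dec-false (u ≟ v) u≢v = cong (λ b → if b then 1 else 0) (edgeUnsat-sym v<u)
  ... | tri≈ _ refl _  | no _    | no _ rewrite dec-true (u ≟ u) refl = refl
  ... | tri< _ _ v≮u   | _       | yes v<u = ⊥-elim (v≮u v<u)
  ... | tri< u<v _ _   | no u≮v  | _       = ⊥-elim (u≮v u<v)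
  ... | tri> u≮v _ _   | yes u<v | _       = ⊥-elim (u≮v u<v)
  ... | tri> _ _ v<u   | _       | no v≮u  = ⊥-elim (v≮u v<u)
  ... | tri≈ u≮u _ _   | yes u<u | _       = ⊥-elim (u≮u u<u)
  ... | tri≈ _ _ v≮v   | _       | yes v<v = ⊥-elim (v≮v v<v)

  redDeg≡∑redForward+redBackward : ∀ v → redDeg c x v ≡ ∑[ u < n ] (redForward u v + redForward v u)
  redDeg≡∑redForward+redBackward v = trans
    (countFin≡∑ (λ u → ¬? (u ≟ v) ×-dec edgeUnsat? c x u v))
    (sum-cong-≗ (λ u → redIncident≡redForward+redBackward u v (u <? v) (v <? u)))

  ∑redDeg≡2*cost : ∑[ v < n ] redDeg c x v ≡ 2 * cost c x
  ∑redDeg≡2*cost = begin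
    ∑[ v < n ] redDeg c x v
      ≡⟨ sum-cong-≗ redDeg≡∑redForward+redBackward ⟩
    ∑[ v < n ] ∑[ u < n ] (redForward u v + redForward v u)
      ≡⟨ sum-cong-≗ (λ v → ∑-distrib-+ (λ u → redForward u v) (redForward v)) ⟩
    ∑[ v < n ] (∑[ u < n ] redForward u v + ∑[ u < n ] redForward v u)
      ≡⟨ ∑-distrib-+ (λ v → ∑[ u < n ] redForward u v) (λ v → ∑[ u < n ] redForward v u) ⟩
    ∑[ v < n ] ∑[ u < n ] redForward u v + ∑[ v < n ] ∑[ u < n ] redForward v u
      ≡⟨ cong (_+ ∑[ v < n ] ∑[ u < n ] redForward v u) (∑-comm (λ v u → redForward u v)) ⟩
    ∑[ u < n ] ∑[ v < n ] redForward u v + ∑[ v < n ] ∑[ u < n ] redForward v u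
      ≡⟨ cong₂ _+_ (sym cost≡∑∑redForward) (sym cost≡∑∑redForward) ⟩
    cost c x + cost c x
      ≡⟨ cong (cost c x +_) (sym (+-identityʳ _)) ⟩
    2 * cost c x ∎
    where open ≡-Reasoning

numFlippable-bound : ∀ {n q} .{{_ : NonZero q}} (c : Labels n q) (x : Assignment n q) →
  (n ∸ 1) * (numFlippable c x * (edges n ∸ 2 * cost c x)) ≤ (n ∸ 1) * (2 * cost c x * n)
numFlippable-bound {n} c x = begin
  (n ∸ 1) * (numFlippable c x * K)               ≡⟨ x∙yz≈y∙xz (n ∸ 1) (numFlippable c x) K ⟩
  numFlippable c x * ((n ∸ 1) * K)               ≤⟨ markov ((n ∸ 1) * K) (λ v → 2 * edges n * redDeg c x v) ⟩
  ∑[ v < n ] (2 * edges n * redDeg c x v)        ≡⟨ *-distribˡ-sum (2 * edges n) (redDeg c x) ⟨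
  2 * edges n * ∑[ v < n ] redDeg c x v          ≡⟨ cong₂ _*_ (2*nC2≡n*[n∸1] n) (∑redDeg≡2*cost c x) ⟩
  n * (n ∸ 1) * (2 * cost c x)                   ≡⟨ xy∙z≈y∙zx n (n ∸ 1) (2 * cost c x) ⟩
  (n ∸ 1) * (2 * cost c x * n)                   ∎
  where
  open ≤-Reasoning
  open CommutativeSemigroupProperties *-commutativeSemigroup using (x∙yz≈y∙xz; xy∙z≈y∙zx)
  K : ℕ
  K = edges n ∸ 2 * cost c x

lemma3 : (n q : ℕ) .{{_ : NonZero q}} (c : Labels n q) → Antisymmetric c →
           (opt : Assignment n q) → Optimal c opt →
           2 * cost c opt < edges n →
           numFlippable c opt * (edges n ∸ 2 * cost c opt) ≤ 2 * cost c opt * n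
lemma3 zero          _ _ _ _   _ ()
lemma3 (suc zero)    _ _ _ _   _ ()
lemma3 (suc (suc k)) _ c _ opt _ _ = *-cancelˡ-≤ (suc k) (numFlippable-bound c opt)
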